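{- Let $\mathcal S=(a,I,\tau)$ be an array-based system, $U$ an $\exists^I$-formula, and $\mathsf{Choose}$ any function mapping each $\exists^I$-formula to a finite (possibly empty) set of $\exists^I$-formulae. If the procedure $\mathsf{BReach{+}Inv}(U)$ terminates returning $\mathsf{safe}$, then $\mathcal S$ is safe with respect to $U$; if it terminates returning $\mathsf{unsafe}$, then $\mathcal S$ is unsafe with respect to $U$.
   Context: Fix theories $T_I=(\Sigma_I,\mathcal C_I)$ (sort INDEX) and $T_E=(\Sigma_E,\mathcal C_E)$ (sort ELEM). $A_I^E$ has sorts INDEX, ELEM, ARRAY, signature $\Sigma_I\cup\Sigma_E\cup\{\_[\_]\}$ ($\_[\_]$: ARRAY$\times$INDEX$\to$ELEM); its models are the three-sorted structures with INDEX-part a model of $T_I$, ELEM-part a model of $T_E$, ARRAY the set of all total functions INDEX$\to$ELEM, $a[i]$ function application. An $\exists^I$-formula is $\exists\underline i\,\phi(\underline i,a[\underline i])$, a $\forall^I$-formula $\forall\underline i\,\phi(\underline i,a[\underline i])$, with $\phi(\underline i,\underline e)$ quantifier-free over $\Sigma_I\cup\Sigma_E$ and $a[\underline i]$ substituted for $\underline e$. Standing assumptions: $T_I$ is locally finite and closed under substructures; quantifier-free satisfiability modulo $T_I$ and $T_E$ is decidable. An array-based system is $\mathcal S=(a,I,\tau)$ with $I$ a $\forall^I$-formula and $\tau(a,a')$ a finite disjunction of formulae $\exists\underline i\,(\phi_L(\underline i,a[\underline i])\wedge\forall j\,a'[j]=F_G(\underline i,a[\underline i],j,a[j]))$, $\phi_L$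 quantifier-free, $F_G$ a case-defined function (defined by cases over quantifier-free conditions exhaustive and pairwise exclusive modulo the theory). $\mathcal S$ is unsafe w.r.t. $U$ if for some $n\ge0$, $I(a_0)\wedge\tau(a_0,a_1)\wedge\dots\wedge\tau(a_{n-1},a_n)\wedge U(a_n)$ is $A_I^E$-satisfiable, and safe otherwise. $Pre(\tau,K):=\exists a'(\tau(a,a')\wedge K(a'))$, $A_I^E$-equivalent to an effectively computable $\exists^I$-formula when $K$ is one. $\mathsf{BReach}(V)$: $P:=V$, $B:=\bot$; while $P\wedge\neg B$ is $A_I^E$-satisfiable do: if $I\wedge P$ is $A_I^E$-satisfiable then return unsafe; $B:=P\vee B$; $P:=Pre(\tau,P)$; end while; return $(\mathsf{safe},B)$. $\mathsf{BReach{+}Inv}(U)$ is $\mathsf{BReach}(U)$ with the following step inserted after $B:=P\vee B$ and before $P:=Pre(\tau,P)$: for each $C\in\mathsf{Choose}(P)$, run $\mathsf{BReach}(C)$; if it returns $(\mathsf{safe},B_C)$ then set $B:=B\vee B_C$. -}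

module Defs where

open import Data.Nat using (ℕ; zero; suc)
open import Data.Fin using (Fin; zero; suc; inject₁; fromℕ)
open import Data.Product using (Σ; _×_; _,_; proj₁)
open import Data.Sum using (_⊎_; inj₁; inj₂)
open import Data.Unit using (⊤; tt)
open import Data.List using (List; []; _∷_; _++_)
open import Data.List.Relation.Unary.Any using (Any)
open import Relation.Nullary using (¬_; Dec)
open import Relation.Binary.PropositionalEquality using (_≡_)
open import Function using (_∘_)
open import Function.Bundles using (_↔_; _⇔_)
open import Function.Definitions using (Injective)

record Signature : Set₁ where
  field
    Fun    : Set
    fArity : Fun → ℕ
    Rel    : Set
    rArity : Rel → ℕ

record Structure (Sg : Signature) : Set₁ where
  open Signature Sg
  field
    Carrier : Set
    fun     : (f : Fun) → (Fin (fArity f) → Carrier) → Carrier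
    rel     : (r : Rel) → (Fin (rArity r) → Carrier) → Set

open Structure public

data Term (Sg : Signature) (X : Set) : Set where
  var : X → Term Sg X
  app : (f : Signature.Fun Sg) → (Fin (Signature.fArity Sg f) → Term Sg X) → Term Sg X

eval : ∀ {Sg X} (M : Structure Sg) → (X → Carrier M) → Term Sg X → Carrier M
eval M ν (var x)    = ν x
eval M ν (app f ts) = fun M f (λ k → eval M ν (ts k))

data Atom (Sg : Signature) (X : Set) : Set where
  _≐_   : Term Sg X → Term Sg X → Atom Sg X
  relAt : (r : Signature.Rel Sg) → (Fin (Signature.rArity Sg r) → Term Sg X) → Atom Sg X

holdsAtom : ∀ {Sg X} (M : Structure Sg) → (X → Carrier M) → Atom Sg X → Set
holdsAtom M ν (t ≐ u)      = eval M ν t ≡ eval M ν u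
holdsAtom M ν (relAt r ts) = rel M r (λ k → eval M ν (ts k))

data BF (A : Set) : Set where
  atom  : A → BF A
  true  : BF A
  false : BF A
  not   : BF A → BF A
  _and_ : BF A → BF A → BF A
  _or_  : BF A → BF A → BF A

data Empty : Set where

⟦_⟧B : ∀ {A : Set} → BF A → (A → Set) → Set
⟦ atom x  ⟧B h = h x
⟦ true    ⟧B h = ⊤
⟦ false   ⟧B h = Empty
⟦ not φ   ⟧B h = ¬ ⟦ φ ⟧B h
⟦ φ and ψ ⟧B h = ⟦ φ ⟧B h × ⟦ ψ ⟧B h
⟦ φ or ψ  ⟧B h = ⟦ φ ⟧B h ⊎ ⟦ ψ ⟧B h

QF : Signature → Set → Set
QF Sg X = BF (Atom Sg X)

holdsQF : ∀ {Sg X} (M : Structure Sg) → (X → Carrier M) → QF Sg X → Set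
holdsQF M ν φ = ⟦ φ ⟧B (holdsAtom M ν)

record Theory : Set₂ where
  field
    sig   : Signature
    Model : Structure sig → Set

open Theory public

Finite : Set → Set
Finite A = Σ ℕ (λ n → A ↔ Fin n)

TermEquiv : (T : Theory) {X : Set} → Term (sig T) X → Term (sig T) X → Set₁
TermEquiv T t u = ∀ (M : Structure (sig T)) → Model T M → ∀ ν → eval M ν t ≡ eval M ν u

LocallyFinite : Theory → Set₁
LocallyFinite T =
  Finite (Signature.Fun (sig T)) × Finite (Signature.Rel (sig T)) ×
  (∀ (n : ℕ) → Σ (List (Term (sig T) (Fin n)))
       (λ ts → ∀ (u : Term (sig T) (Fin n)) → Any (λ t → TermEquiv T u t) ts))

-- N is (isomorphic to) a substructure of M
record Embedding {Sg : Signature} (N M : Structure Sg) : Set where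
  field
    h      : Carrier N → Carrier M
    inj    : Injective _≡_ _≡_ h
    presF  : ∀ f xs → h (fun N f xs) ≡ fun M f (h ∘ xs)
    presR  : ∀ r xs → rel N r xs ⇔ rel M r (h ∘ xs)

ClosedUnderSubstructures : Theory → Set₁
ClosedUnderSubstructures T =
  ∀ (M N : Structure (sig T)) → Model T M → Embedding N M → Model T N

QFSatDecidable : Theory → Set₁
QFSatDecidable T =
  ∀ (n : ℕ) (φ : QF (sig T) (Fin n)) →
    Dec (Σ (Structure (sig T)) λ M → Model T M ×
           Σ (Fin n → Carrier M) λ ν → holdsQF M ν φ)

module _ (TI TE : Theory) where

  ΣI ΣE : Signature
  ΣI = sig TI
  ΣE = sig TE

  -- models of A_I^E: INDEX part a model of T_I, ELEM part a model of T_E,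
  -- ARRAY = all total functions INDEX → ELEM
  record AModel : Set₁ where
    field
      MI : Structure ΣI
      mI : Model TI MI
      ME : Structure ΣE
      mE : Model TE ME

  Idx Elm : AModel → Set
  Idx M = Carrier (AModel.MI M)
  Elm M = Carrier (AModel.ME M)

  Arr : AModel → Set
  Arr M = Idx M → Elm M

  QF2 : Set → Set → Set
  QF2 X Y = BF (Atom ΣI X ⊎ Atom ΣE Y)

  holds2 : ∀ {X Y} (M : AModel) → (X → Idx M) → (Y → Elm M) → QF2 X Y → Set
  holds2 M ι ε φ = ⟦ φ ⟧B h
    where
      h : _ → Set
      h (inj₁ a) = holdsAtom (AModel.MI M) ι a
      h (inj₂ a) = holdsAtom (AModel.ME M) ε a

  record EFormula : Set where
    field
      n : ℕ
      φ : QF2 (Fin n) (Fin n)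

  ⟦_⟧∃ : EFormula → (M : AModel) → Arr M → Set
  ⟦ F ⟧∃ M a = Σ (Fin (EFormula.n F) → Idx M) λ ι → holds2 M ι (a ∘ ι) (EFormula.φ F)

  record AFormula : Set where
    field
      n : ℕ
      φ : QF2 (Fin n) (Fin n)

  ⟦_⟧∀ : AFormula → (M : AModel) → Arr M → Set
  ⟦ F ⟧∀ M a = ∀ (ι : Fin (AFormula.n F) → Idx M) → holds2 M ι (a ∘ ι) (AFormula.φ F)

  ext : ∀ {n} {A : Set} → (Fin n → A) → A → Fin n ⊎ ⊤ → A
  ext ι j (inj₁ k) = ι k
  ext ι j (inj₂ _) = j

  -- a case-defined function F_G(i, a[i], j, a[j]):
  -- cases κ_h(i, a[i], j, a[j]) ↦ t_h(a[i], a[j]),  h < m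
  record CaseDef (n : ℕ) : Set₁ where
    field
      m    : ℕ
      cond : Fin m → QF2 (Fin n ⊎ ⊤) (Fin n ⊎ ⊤)
      val  : Fin m → Term ΣE (Fin n ⊎ ⊤)
      exhaustive : ∀ (M : AModel) (a : Arr M) (ι : Fin n → Idx M) (j : Idx M) →
                   Σ (Fin m) λ h → holds2 M (ext ι j) (a ∘ ext ι j) (cond h)
      exclusive  : ∀ (M : AModel) (a : Arr M) (ι : Fin n → Idx M) (j : Idx M) (h h' : Fin m) →
                   holds2 M (ext ι j) (a ∘ ext ι j) (cond h) →
                   holds2 M (ext ι j) (a ∘ ext ι j) (cond h') → h ≡ h'

  record Transition : Set₁ where
    field
      n     : ℕ
      guard : QF2 (Fin n) (Fin n)
      upd   : CaseDef n

  ⟦_⟧T : Transition → (M : AModel) → Arr M → Arr M → Set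
  ⟦ t ⟧T M a a' =
    Σ (Fin n → Idx M) λ ι → holds2 M ι (a ∘ ι) guard ×
      (∀ (j : Idx M) (h : Fin (CaseDef.m upd)) →
         holds2 M (ext ι j) (a ∘ ext ι j) (CaseDef.cond upd h) →
         a' j ≡ eval (AModel.ME M) (a ∘ ext ι j) (CaseDef.val upd h))
    where open Transition t

  record System : Set₁ where
    field
      init  : AFormula
      trans : List Transition

  τ⟦_⟧ : System → (M : AModel) → Arr M → Arr M → Set
  τ⟦ S ⟧ M a a' = disj (System.trans S)
    where
      disj : List Transition → Set
      disj []       = Empty
      disj (t ∷ ts) = ⟦ t ⟧T M a a' ⊎ disj ts

  UnsafeWrt : System → EFormula → Set₁
  UnsafeWrt S U =
    Σ ℕ λ n → Σ AModel λ M → Σ (Fin (suc n) → Arr M) λ as →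
      ⟦ System.init S ⟧∀ M (as zero) ×
      (∀ (k : Fin n) → τ⟦ S ⟧ M (as (inject₁ k)) (as (suc k))) ×
      ⟦ U ⟧∃ M (as (fromℕ n))

  SafeWrt : System → EFormula → Set₁
  SafeWrt S U = ¬ UnsafeWrt S U

  PreSpec : System → (EFormula → EFormula) → Set₁
  PreSpec S pre = ∀ (K : EFormula) (M : AModel) (a : Arr M) →
    ⟦ pre K ⟧∃ M a ⇔ (Σ (Arr M) λ a' → τ⟦ S ⟧ M a a' × ⟦ K ⟧∃ M a')

  ⟦_⟧∨ : List EFormula → (M : AModel) → Arr M → Set
  ⟦ B ⟧∨ M a = Any (λ C → ⟦ C ⟧∃ M a) B

  SatPnotB : EFormula → List EFormula → Set₁
  SatPnotB P B = Σ AModel λ M → Σ (Arr M) λ a → ⟦ P ⟧∃ M a × ¬ ⟦ B ⟧∨ M a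

  SatIP : System → EFormula → Set₁
  SatIP S P = Σ AModel λ M → Σ (Arr M) λ a → ⟦ System.init S ⟧∀ M a × ⟦ P ⟧∃ M a

  data Result : Set where
    unsafe : Result
    safe   : List EFormula → Result

  -- Big-step semantics of the procedures:  "X ⇓ r"  means the run
  -- terminates and returns r.  pre computes Pre(τ,_).

  module Procedures (S : System) (pre : EFormula → EFormula) where

    data Loop : EFormula → List EFormula → Result → Set₂ where
      exit   : ∀ {P B} → ¬ SatPnotB P B → Loop P B (safe B)
      found  : ∀ {P B} → SatPnotB P B → SatIP S P → Loop P B unsafe
      iter   : ∀ {P B r} → SatPnotB P B → ¬ SatIP S P →
               Loop (pre P) (P ∷ B) r → Loop P B r

    BReach : EFormula → Result → Set₂
    BReach V r = Loop V [] r

    module WithChoose (choose : EFormula → List EFormula) where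

      data InvStep : List EFormula → List EFormula → List EFormula → Set₂ where
        done    : ∀ {B} → InvStep [] B B
        addSafe : ∀ {C Cs B BC B'} → BReach C (safe BC) →
                  InvStep Cs (B ++ BC) B' → InvStep (C ∷ Cs) B B'
        skipUns : ∀ {C Cs B B'} → BReach C unsafe →
                  InvStep Cs B B' → InvStep (C ∷ Cs) B B'

      data LoopInv : EFormula → List EFormula → Result → Set₂ where
        exit   : ∀ {P B} → ¬ SatPnotB P B → LoopInv P B (safe B)
        found  : ∀ {P B} → SatPnotB P B → SatIP S P → LoopInv P B unsafe
        iter   : ∀ {P B B' r} → SatPnotB P B → ¬ SatIP S P →
                 InvStep (choose P) (P ∷ B) B' →
                 LoopInv (pre P) B' r → LoopInv P B r

      BReachInv : EFormula → Result → Set₂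
      BReachInv U r = LoopInv U [] r

module Submission where

-- Nothing about the theories T_I, T_E is needed: the argument is pure
-- reasoning about the transition relation τ inside one fixed model of A_I^E.
--
-- * Safe answers.  Along the loop of BReach with frontier P and visited set B
--   we keep the invariant "B contains no initial state, and every
--   τ-predecessor of B lies in B or in P".  When the loop exits, P ⊆ B, so B
--   is closed under predecessors and disjoint from I: a certificate.  The
--   sets B_C returned by the nested BReach(C) calls are certificates as well,
--   and adding a certificate to B preserves the invariant.  The outer loop
--   also keeps U ⊆ B ∪ P, hence U ⊆ B at exit; walking an I-to-U trace
--   backwards through a closed B reaches an initial state in B.
-- * Unsafe answers.  Every frontier P only contains states from which U is
--   reachable (Pre is exact), so a satisfiable I ∧ P yields an unsafe trace.
--
-- The exit test is "P ∧ ¬B unsatisfiable", which constructively only gives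
-- P ⊆ ¬¬B; all inclusions into B are therefore stated up to double
-- negation, which is harmless because safety is itself a negation.

open import Defs hiding (_≐_)
open import Level using (0ℓ)
open import Data.Nat using (ℕ; zero; suc)
open import Data.Fin using (Fin; zero; suc; inject₁; fromℕ)
open import Data.Vec.Functional using (Vector; tail) renaming (_∷_ to _◂_)
open import Data.Product using (_×_; _,_; ∃; ∃₂; proj₁; proj₂; swap)
open import Data.Sum using (inj₁; inj₂; [_,_]′; map₁) renaming (swap to ⊎-swap)
open import Data.List using (List; []; _∷_; _++_)
open import Data.List.Relation.Unary.Any.Properties using (∷↔; ++↔)
open import Relation.Nullary using (¬_)
open import Relation.Unary using (Pred; _⊆′_; _≐′_; _∪_; _⊥′_)
open import Relation.Binary.PropositionalEquality using (_≡_; refl)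
open import Function.Bundles using (Equivalence; Inverse)

⊥-∪ : {A : Set} {I X Y Z : Pred A 0ℓ} →
      I ⊥′ X → I ⊥′ Y → Z ⊆′ X ∪ Y → I ⊥′ Z
⊥-∪ I⊥X I⊥Y Z⊆X∪Y s (i , z) =
  [ (λ x → I⊥X s (i , x)) , (λ y → I⊥Y s (i , y)) ]′ (Z⊆X∪Y s z)

-- Inclusions use the explicit-state form _⊆′_, since the predicates it is
-- applied to (meanings of formulas) cannot be inferred from their values.
module BackwardReasoning {St : Set} (_↦_ : St → St → Set) where

  Pre : Pred St 0ℓ → Pred St 0ℓ
  Pre Q s = ∃ λ s' → s ↦ s' × Q s'

  Pre-mono : {P Q : Pred St 0ℓ} → P ⊆′ Q → Pre P ⊆′ Pre Q
  Pre-mono P⊆Q _ (s' , step , p) = s' , step , P⊆Q s' p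

  infix 4 _⊆¬¬_
  _⊆¬¬_ : Pred St 0ℓ → Pred St 0ℓ → Set
  P ⊆¬¬ Q = P ⊆′ λ s → ¬ ¬ Q s

  ⊆¬¬-weaken : {P Q R : Pred St 0ℓ} → P ⊆¬¬ Q → Q ⊆′ R → P ⊆¬¬ R
  ⊆¬¬-weaken P⊆Q Q⊆R s p ¬r = P⊆Q s p λ q → ¬r (Q⊆R s q)

  ⊆¬¬-∪-elim : {P B Q : Pred St 0ℓ} → P ⊆¬¬ B ∪ Q → Q ⊆¬¬ B → P ⊆¬¬ B
  ⊆¬¬-∪-elim P⊆B∪Q Q⊆B s p ¬b = P⊆B∪Q s p [ ¬b , (λ q → Q⊆B s q ¬b) ]′

  Closed : Pred St 0ℓ → Set
  Closed B = Pre B ⊆¬¬ B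

  ClosedUpTo : Pred St 0ℓ → Pred St 0ℓ → Set
  ClosedUpTo B Q = Pre B ⊆¬¬ B ∪ Q

  closedUpTo-resp : {B B' Q : Pred St 0ℓ} → B ≐′ B' → ClosedUpTo B Q → ClosedUpTo B' Q
  closedUpTo-resp (B⊆B' , B'⊆B) closed =
    ⊆¬¬-weaken (λ s pre → closed s (Pre-mono B'⊆B s pre)) (λ s → map₁ (B⊆B' s))

  closedUpTo-step : {B P P' : Pred St 0ℓ} →
                    ClosedUpTo B P → Pre P ⊆′ P' → ClosedUpTo (P ∪ B) P'
  closedUpTo-step _ Pre⊆P' s (s' , step , inj₁ p) ¬r = ¬r (inj₂ (Pre⊆P' s (s' , step , p)))
  closedUpTo-step closed _ s (s' , step , inj₂ b) ¬r =
    closed s (s' , step , b) λ b∪p → ¬r (inj₁ (⊎-swap b∪p))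

  closedUpTo-join : {B C Q : Pred St 0ℓ} → ClosedUpTo B Q → Closed C → ClosedUpTo (B ∪ C) Q
  closedUpTo-join closedB _ s (s' , step , inj₁ b) ¬r =
    closedB s (s' , step , b) λ b∪q → ¬r (map₁ inj₁ b∪q)
  closedUpTo-join _ closedC s (s' , step , inj₂ c) ¬r =
    closedC s (s' , step , c) λ c → ¬r (inj₁ (inj₂ c))

  Path : (n : ℕ) → Vector St (suc n) → Set
  Path n ss = (k : Fin n) → ss (inject₁ k) ↦ ss (suc k)

  closed-along-path : {B : Pred St 0ℓ} → Closed B → (n : ℕ) (ss : Vector St (suc n)) →
                      Path n ss → ¬ ¬ B (ss (fromℕ n)) → ¬ ¬ B (ss zero)
  closed-along-path _      zero    ss path b = b
  closed-along-path closed (suc n) ss path b ¬b₀ =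
    closed-along-path closed n (tail ss) (λ k → path (suc k)) b
      λ b₁ → closed (ss zero) (ss (suc zero) , path zero , b₁) ¬b₀

  Reaches : Pred St 0ℓ → Pred St 0ℓ
  Reaches U s = ∃₂ λ n (ss : Vector St (suc n)) →
                  ss zero ≡ s × Path n ss × U (ss (fromℕ n))

  reaches-here : {U : Pred St 0ℓ} → U ⊆′ Reaches U
  reaches-here s u = 0 , (λ _ → s) , refl , (λ ()) , u

  reaches-pre : {U : Pred St 0ℓ} → Pre (Reaches U) ⊆′ Reaches U
  reaches-pre s (s' , step , n , ss , refl , path , u) =
    suc n , s ◂ ss , refl , path' , u
    where
      path' : Path (suc n) (s ◂ ss)
      path' zero    = step
      path' (suc k) = path k

module Soundness (TI TE : Theory) (S : System TI TE)
                 (pre : EFormula TI TE → EFormula TI TE)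
                 (pre-spec : PreSpec TI TE S pre)
                 (choose : EFormula TI TE → List (EFormula TI TE)) where

  open Procedures TI TE S pre
  open WithChoose choose

  Formula : Set
  Formula = EFormula TI TE

  variable
    P U : Formula
    B B' Cs : List Formula

  module InModel (M : AModel TI TE) where

    open BackwardReasoning (τ⟦_⟧ TI TE S M) public

    State : Set
    State = Arr TI TE M

    Init : Pred State 0ℓ
    Init = ⟦_⟧∀ TI TE (System.init S) M

    ⟦_⟧ : Formula → Pred State 0ℓ
    ⟦ P ⟧ = ⟦_⟧∃ TI TE P M

    ⟦_⟧* : List Formula → Pred State 0ℓ
    ⟦ B ⟧* = ⟦_⟧∨ TI TE B M

    ⟦∷⟧ : ⟦ P ∷ B ⟧* ≐′ ⟦ P ⟧ ∪ ⟦ B ⟧*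
    ⟦∷⟧ = (λ _ → Inverse.from (∷↔ _)) , (λ _ → Inverse.to (∷↔ _))

    ⟦++⟧ : ⟦ B ++ B' ⟧* ≐′ ⟦ B ⟧* ∪ ⟦ B' ⟧*
    ⟦++⟧ = (λ _ → Inverse.from ++↔) , (λ _ → Inverse.to ++↔)

    pre-sound : Pre ⟦ P ⟧ ⊆′ ⟦ pre P ⟧
    pre-sound a = Equivalence.from (pre-spec _ M a)

    pre-complete : ⟦ pre P ⟧ ⊆′ Pre ⟦ P ⟧
    pre-complete a = Equivalence.to (pre-spec _ M a)

    frontier-covered : ¬ SatPnotB TI TE P B → ⟦ P ⟧ ⊆¬¬ ⟦ B ⟧*
    frontier-covered unsat a p ¬b = unsat (M , a , p , ¬b)

    frontier-avoids-init : ¬ SatIP TI TE S P → Init ⊥′ ⟦ P ⟧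
    frontier-avoids-init unsat a (i , p) = unsat (M , a , i , p)

    record Invariant (B : List Formula) (Q : Pred State 0ℓ) : Set where
      field
        avoids-init : Init ⊥′ ⟦ B ⟧*
        closed-upto : ClosedUpTo ⟦ B ⟧* Q

    record Certificate (B : List Formula) : Set where
      field
        avoids-init : Init ⊥′ ⟦ B ⟧*
        closed      : Closed ⟦ B ⟧*

    open Invariant
    open Certificate

    invariant-init : {Q : Pred State 0ℓ} → Invariant [] Q
    invariant-init = record
      { avoids-init = λ { _ (_ , ()) }
      ; closed-upto = λ { _ (_ , _ , ()) }
      }

    invariant-step : ¬ SatIP TI TE S P → Invariant B ⟦ P ⟧ → Invariant (P ∷ B) ⟦ pre P ⟧
    invariant-step {P} {B} noInit inv = record
      { avoids-init = ⊥-∪ (frontier-avoids-init {P} noInit) (avoids-init inv) (proj₁ (⟦∷⟧ {P} {B}))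
      ; closed-upto = closedUpTo-resp (swap (⟦∷⟧ {P} {B}))
                        (closedUpTo-step (closed-upto inv) (pre-sound {P}))
      }

    invariant-exit : ¬ SatPnotB TI TE P B → Invariant B ⟦ P ⟧ → Certificate B
    invariant-exit {P} {B} covered inv = record
      { avoids-init = avoids-init inv
      ; closed      = ⊆¬¬-∪-elim (closed-upto inv) (frontier-covered {P} {B} covered)
      }

    invariant-join : {Q : Pred State 0ℓ} →
                     Invariant B Q → Certificate B' → Invariant (B ++ B') Q
    invariant-join {B} {B'} inv cert = record
      { avoids-init = ⊥-∪ (avoids-init inv) (avoids-init cert) (proj₁ (⟦++⟧ {B} {B'}))
      ; closed-upto = closedUpTo-resp (swap (⟦++⟧ {B} {B'}))
                        (closedUpTo-join (closed-upto inv) (closed cert))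
      }

    bReach-certificate : Loop P B (safe B') → Invariant B ⟦ P ⟧ → Certificate B'
    bReach-certificate {P} {B} (exit covered) inv = invariant-exit {P} {B} covered inv
    bReach-certificate (iter _ noInit run) inv = bReach-certificate run (invariant-step noInit inv)

    invStep-invariant : {Q : Pred State 0ℓ} →
                        InvStep Cs B B' → Invariant B Q → Invariant B' Q × ⟦ B ⟧* ⊆′ ⟦ B' ⟧*
    invStep-invariant done inv = inv , λ _ b → b
    invStep-invariant {B = B} (addSafe {BC = BC} run rest) inv
      with invStep-invariant rest (invariant-join inv (bReach-certificate run invariant-init))
    ... | inv' , B++BC⊆B' = inv' , λ a b → B++BC⊆B' a (proj₂ (⟦++⟧ {B} {BC}) a (inj₁ b))
    invStep-invariant (skipUns _ rest) inv = invStep-invariant rest inv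

    bReachInv-certificate : LoopInv P B (safe B') → Invariant B ⟦ P ⟧ →
                            ⟦ U ⟧ ⊆¬¬ ⟦ B ⟧* ∪ ⟦ P ⟧ → Certificate B' × ⟦ U ⟧ ⊆¬¬ ⟦ B' ⟧*
    bReachInv-certificate {P} {B} (exit covered) inv U⊆B∪P =
      invariant-exit {P} {B} covered inv , ⊆¬¬-∪-elim U⊆B∪P (frontier-covered {P} {B} covered)
    bReachInv-certificate {P} {B} {U = U} (iter {B' = B₁} _ noInit strengthen run) inv U⊆B∪P
      with invStep-invariant strengthen (invariant-step noInit inv)
    ... | inv' , P∷B⊆B₁ = bReachInv-certificate {U = U} run inv' (⊆¬¬-weaken U⊆B∪P B∪P⊆B₁)
      where
        B∪P⊆B₁ : ⟦ B ⟧* ∪ ⟦ P ⟧ ⊆′ ⟦ B₁ ⟧* ∪ ⟦ pre P ⟧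
        B∪P⊆B₁ a b∪p = inj₁ (P∷B⊆B₁ a (proj₂ (⟦∷⟧ {P} {B}) a (⊎-swap b∪p)))

    certificate-safe : Certificate B → ⟦ U ⟧ ⊆¬¬ ⟦ B ⟧* →
                       (n : ℕ) (ss : Vector State (suc n)) →
                       Init (ss zero) → Path n ss → ¬ ⟦ U ⟧ (ss (fromℕ n))
    certificate-safe cert U⊆B n ss i path u =
      closed-along-path (closed cert) n ss path (U⊆B (ss (fromℕ n)) u)
        λ b → avoids-init cert (ss zero) (i , b)

  -- safe answers: an unsafe trace would end in U ⊆ B and start in I, which B avoids
  bReachInv-safe : BReachInv U (safe B) → SafeWrt TI TE S U
  bReachInv-safe {U} {B} run (n , M , ss , i , path , u) =
    certificate-safe {U = U} cert U⊆B n ss i path u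
    where
      open InModel M
      certified : Certificate B × ⟦ U ⟧ ⊆¬¬ ⟦ B ⟧*
      certified = bReachInv-certificate {U = U} run invariant-init λ _ u ¬b∪u → ¬b∪u (inj₂ u)
      cert = proj₁ certified
      U⊆B = proj₂ certified

  bReachInv-reaches : LoopInv P B unsafe →
                      ((M : AModel TI TE) → let open InModel M in ⟦ P ⟧ ⊆′ Reaches ⟦ U ⟧) →
                      UnsafeWrt TI TE S U
  bReachInv-reaches (found _ (M , a , i , p)) P⊆Reaches with P⊆Reaches M a p
  ... | n , ss , refl , path , u = n , M , ss , i , path , u
  bReachInv-reaches {P} {U = U} (iter _ _ _ run) P⊆Reaches =
    bReachInv-reaches {U = U} run λ M a p → let open InModel M in
      reaches-pre {⟦ U ⟧} a (Pre-mono {⟦ P ⟧} (P⊆Reaches M) a (pre-complete {P} a p))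

  -- unsafe answers: initially the frontier is U itself
  bReachInv-unsafe : BReachInv U unsafe → UnsafeWrt TI TE S U
  bReachInv-unsafe {U} run =
    bReachInv-reaches {U = U} run λ M → InModel.reaches-here M {InModel.⟦ M ⟧ U}

proposition6p1 :
    (TI TE : Theory) →
    LocallyFinite TI → ClosedUnderSubstructures TI →
    QFSatDecidable TI → QFSatDecidable TE →
    (S : System TI TE) (pre : EFormula TI TE → EFormula TI TE) →
    PreSpec TI TE S pre →
    (U : EFormula TI TE) (choose : EFormula TI TE → List (EFormula TI TE)) →
      ((B : List (EFormula TI TE)) →
         Procedures.WithChoose.BReachInv TI TE S pre choose U (safe B) →
         SafeWrt TI TE S U)
      ×
      (Procedures.WithChoose.BReachInv TI TE S pre choose U unsafe →
         UnsafeWrt TI TE S U)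
proposition6p1 TI TE _ _ _ _ S pre pre-spec U choose =
  (λ _ → bReachInv-safe) , bReachInv-unsafe
  where open Soundness TI TE S pre pre-spec choose
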